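{- Every D3-reducible graph is 3-vertex-connected.
   Context: All graphs are finite and simple. The D3 reductions are the following two operations on a graph $G$. (D3a) Let $p,q,r$ be three vertices of degree three that induce a triangle in $G$ and whose neighbors outside $\{p,q,r\}$ are three distinct vertices; replace $p,q,r$ by a single new vertex adjacent to exactly those three outside neighbors. (D3b) Let $p,q,r$ be three vertices of degree three that induce a path with middle vertex $q$, and suppose there is a single vertex $s$ adjacent to all three of $p,q,r$; delete $q$ and add a new edge from $p$ to $r$. A graph is D3-reducible if it can be transformed into a graph isomorphic to $K_4$ by a finite sequence of D3 reductions. -}

module Defs where

open import Data.Nat using (ℕ; _≤_)
open import Data.Fin using (Fin)
open import Data.Bool using (Bool; true; false; not)
open import Data.List using (List; length; filterᵇ; allFin)
open import Data.List.Membership.Propositional using (_∉_)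
open import Data.Product using (Σ; ∃; _×_; _,_)
open import Data.Sum using (_⊎_)
open import Relation.Binary.PropositionalEquality using (_≡_; _≢_)
open import Relation.Nullary using (¬_; does)
open import Data.Fin using (_≟_)
open import Function.Bundles using (_↔_; Inverse)

record Graph : Set where
  field
    n      : ℕ
    adj    : Fin n → Fin n → Bool
    sym    : ∀ x y → adj x y ≡ adj y x
    irrefl : ∀ x → adj x x ≡ false
open Graph public

Adj : (G : Graph) → Fin (n G) → Fin (n G) → Set
Adj G x y = adj G x y ≡ true

degree : (G : Graph) → Fin (n G) → ℕ
degree G v = length (filterᵇ (adj G v) (allFin (n G)))

_≅_ : Graph → Graph → Set
G ≅ H = Σ (Fin (n G) ↔ Fin (n H)) λ φ →
          ∀ x y → adj H (Inverse.to φ x) (Inverse.to φ y) ≡ adj G x y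

K4 : Graph
K4 = record
  { n = 4
  ; adj = λ x y → not (does (x ≟ y))
  ; sym = sym4
  ; irrefl = irr4
  }
  where
  open import Relation.Binary.PropositionalEquality using (refl)
  open import Data.Fin using (zero; suc)
  sym4 : ∀ (x y : Fin 4) → not (does (x ≟ y)) ≡ not (does (y ≟ x))
  sym4 zero zero = refl
  sym4 zero (suc zero) = refl
  sym4 zero (suc (suc zero)) = refl
  sym4 zero (suc (suc (suc zero))) = refl
  sym4 (suc zero) zero = refl
  sym4 (suc zero) (suc zero) = refl
  sym4 (suc zero) (suc (suc zero)) = refl
  sym4 (suc zero) (suc (suc (suc zero))) = refl
  sym4 (suc (suc zero)) zero = refl
  sym4 (suc (suc zero)) (suc zero) = refl
  sym4 (suc (suc zero)) (suc (suc zero)) = refl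
  sym4 (suc (suc zero)) (suc (suc (suc zero))) = refl
  sym4 (suc (suc (suc zero))) zero = refl
  sym4 (suc (suc (suc zero))) (suc zero) = refl
  sym4 (suc (suc (suc zero))) (suc (suc zero)) = refl
  sym4 (suc (suc (suc zero))) (suc (suc (suc zero))) = refl
  irr4 : ∀ (x : Fin 4) → not (does (x ≟ x)) ≡ false
  irr4 zero = refl
  irr4 (suc zero) = refl
  irr4 (suc (suc zero)) = refl
  irr4 (suc (suc (suc zero))) = refl

-- (D3a) H is (up to isomorphism) the result of contracting the triangle p,q,r
-- of degree-3 vertices, whose outside neighbours a,b,c (of p,q,r resp.) are
-- three distinct vertices, to a single new vertex w adjacent to exactly a,b,c.
D3a : Graph → Graph → Set
D3a G H =
  Σ (Fin (n G)) λ p → Σ (Fin (n G)) λ q → Σ (Fin (n G)) λ r →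
  Σ (Fin (n G)) λ a → Σ (Fin (n G)) λ b → Σ (Fin (n G)) λ c →
    (p ≢ q × q ≢ r × p ≢ r)
  × (degree G p ≡ 3 × degree G q ≡ 3 × degree G r ≡ 3)
  × (Adj G p q × Adj G q r × Adj G p r)
  × (Adj G p a × Adj G q b × Adj G r c)
  × (a ≢ p × a ≢ q × a ≢ r × b ≢ p × b ≢ q × b ≢ r × c ≢ p × c ≢ q × c ≢ r)
  × (a ≢ b × b ≢ c × a ≢ c)
  × Σ (Fin (n G) → Fin (n H)) λ f → Σ (Fin (n H)) λ w →
      (f p ≡ w × f q ≡ w × f r ≡ w)
    × (∀ (y : Fin (n H)) → ∃ λ x → f x ≡ y)
    × (∀ x → x ≢ p → x ≢ q → x ≢ r → f x ≢ w)
    × (∀ x y → x ≢ p → x ≢ q → x ≢ r → y ≢ p → y ≢ q → y ≢ r →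
         f x ≡ f y → x ≡ y)
    × (∀ x y → x ≢ p → x ≢ q → x ≢ r → y ≢ p → y ≢ q → y ≢ r →
         adj H (f x) (f y) ≡ adj G x y)
    × (∀ x → x ≢ p → x ≢ q → x ≢ r →
         (Adj H w (f x) → (x ≡ a ⊎ x ≡ b ⊎ x ≡ c))
       × ((x ≡ a ⊎ x ≡ b ⊎ x ≡ c) → Adj H w (f x)))

-- (D3b) p,q,r of degree 3 induce a path with middle vertex q, and some vertex
-- s is adjacent to all of p,q,r; H is (up to isomorphism) G - q + pr.
D3b : Graph → Graph → Set
D3b G H =
  Σ (Fin (n G)) λ p → Σ (Fin (n G)) λ q → Σ (Fin (n G)) λ r → Σ (Fin (n G)) λ s →
    (p ≢ q × q ≢ r × p ≢ r)
  × (degree G p ≡ 3 × degree G q ≡ 3 × degree G r ≡ 3)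
  × (Adj G p q × Adj G q r × ¬ Adj G p r)
  × (Adj G s p × Adj G s q × Adj G s r)
  × Σ (Fin (n H) → Fin (n G)) λ f →
      (∀ x y → f x ≡ f y → x ≡ y)
    × (∀ x → f x ≢ q)
    × (∀ z → z ≢ q → ∃ λ x → f x ≡ z)
    × (∀ x y → (Adj H x y →
                 (Adj G (f x) (f y) ⊎ (f x ≡ p × f y ≡ r) ⊎ (f x ≡ r × f y ≡ p)))
             × ((Adj G (f x) (f y) ⊎ (f x ≡ p × f y ≡ r) ⊎ (f x ≡ r × f y ≡ p))
                 → Adj H x y))

data D3Step (G H : Graph) : Set where
  stepA : D3a G H → D3Step G H
  stepB : D3b G H → D3Step G H

data D3Reducible : Graph → Set where
  done : ∀ {G} → G ≅ K4 → D3Reducible G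
  step : ∀ {G H} → D3Step G H → D3Reducible H → D3Reducible G

data Walk (G : Graph) (ok : Fin (n G) → Set) : Fin (n G) → Fin (n G) → Set where
  here : ∀ {u} → ok u → Walk G ok u u
  cons : ∀ {u w v} → ok u → Adj G u w → Walk G ok w v → Walk G ok u v

VertexConnected : ℕ → Graph → Set
VertexConnected k G =
  (Data.Nat.suc k ≤ n G) ×
  (∀ (S : List (Fin (n G))) → Data.Nat.suc (length S) ≤ k →
     ∀ u v → u ∉ S → v ∉ S → Walk G (λ x → x ∉ S) u v)

module Submission where

-- K4 is complete, so
-- it stays connected after deleting any vertices.  For a reduction step
-- G ⟶ H we show that 3-connectivity of H lifts back to G.  Given a set S of
-- at most two vertices of G we build a set S' of at most two vertices of H
-- (the image of S under a map k : V(G) → V(H)) and use a section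
-- g : V(H) → V(G) of k (lemma 'Transfer'): every H-edge outside S' is
-- replaced by a walk of G − S, and every vertex of G − S is first led into
-- the image of g.  For D3a, k is the contraction map; a triangle vertex
-- escapes the triangle along one of three disjoint routes ('escape').  For
-- D3b, k is the inverse of the embedding V(H) → V(G) ∖ {q}, with q sent to
-- a preimage of p or r when q ∈ S; the new edge pr is replaced by p–q–r,
-- or avoided altogether.

open import Defs hiding (sym)
open import Data.Nat using (suc; _≤_; _<_; s≤s; s≤s⁻¹)
open import Data.Fin using (Fin; zero; suc; _≟_)
open import Data.Fin.Properties using (injective⇒≤; pigeonhole; ¬∀⟶∃¬; <⇒≢)
open import Data.List using (List; []; _∷_; length; map; lookup)
open import Data.List.Properties using (length-map)
open import Data.List.Membership.Propositional using (_∈_; _∉_)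
open import Data.List.Membership.Propositional.Properties using (∈-map⁺; ∈-map⁻)
import Data.List.Membership.DecPropositional as DecMembership
open import Data.List.Relation.Unary.Any using (here; there; index)
open import Data.List.Relation.Unary.Any.Properties using (lookup-index)
open import Data.Product using (∃; _×_; _,_; proj₁; proj₂)
open import Data.Sum using (_⊎_; inj₁; inj₂)
open import Data.Empty using (⊥; ⊥-elim)
open import Relation.Binary.PropositionalEquality
  using (_≡_; _≢_; refl; sym; trans; cong; cong₂; subst; subst₂; ≢-sym)
open import Relation.Nullary using (¬_; yes; no)
open import Function.Bundles using (Inverse)

V : Graph → Set
V G = Fin (n G)

ConnectedWithout : (G : Graph) → List (V G) → Set
ConnectedWithout G S = ∀ u v → u ∉ S → v ∉ S → Walk G (_∉ S) u v

adjSym : ∀ G {x y} → Adj G x y → Adj G y x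
adjSym G {x} {y} e = trans (Graph.sym G y x) e

adjNe : ∀ G {x y} → Adj G x y → x ≢ y
adjNe G e refl with trans (sym e) (irrefl G _)
... | ()

_++w_ : ∀ {G ok u v w} → Walk G ok u v → Walk G ok v w → Walk G ok u w
here _ ++w q = q
cons o a p ++w q = cons o a (p ++w q)

walkStart : ∀ {G ok u v} → Walk G ok u v → ok u
walkStart (here o) = o
walkStart (cons o _ _) = o

edge : ∀ {G ok u v} → ok u → ok v → Adj G u v → Walk G ok u v
edge ou ov a = cons ou a (here ov)

snocw : ∀ {G ok u v w} → Walk G ok u v → Adj G v w → ok w → Walk G ok u w
snocw (here o) a o' = edge o o' a
snocw (cons o a p) b o' = cons o a (snocw p b o')

rev : ∀ {G ok u v} → Walk G ok u v → Walk G ok v u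
rev (here o) = here o
rev {G} (cons o a p) = snocw (rev p) (adjSym G a) o

mapW : ∀ {G H : Graph} {okH : V H → Set} {okG : V G → Set}
  (g : V H → V G) →
  (∀ y → okH y → okG (g y)) →
  (∀ y y' → okH y → okH y' → Adj H y y' → Walk G okG (g y) (g y')) →
  ∀ {y y'} → Walk H okH y y' → Walk G okG (g y) (g y')
mapW g om em (here o) = here (om _ o)
mapW g om em (cons o a p) = em _ _ o (walkStart p) a ++w mapW g om em p

pigeon₃ : ∀ {m} (S : List (Fin m)) → length S ≤ 2 → ∀ {a b c} →
  a ∈ S → b ∈ S → c ∈ S → a ≢ b → b ≢ c → a ≢ c → ⊥
pigeon₃ (_ ∷ _ ∷ _ ∷ _) (s≤s (s≤s ())) _ _ _ _ _ _
pigeon₃ [] _ () _ _ _ _ _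
pigeon₃ (_ ∷ []) _ (here refl) (here refl) _ ab _ _ = ab refl
pigeon₃ (_ ∷ []) _ _ _ (there ()) _ _ _
pigeon₃ (_ ∷ []) _ _ (there ()) _ _ _ _
pigeon₃ (_ ∷ []) _ (there ()) _ _ _ _ _
pigeon₃ (_ ∷ _ ∷ []) _ (here refl) (here refl) _ ab _ _ = ab refl
pigeon₃ (_ ∷ _ ∷ []) _ (here refl) (there (here refl)) (here refl) _ _ ac = ac refl
pigeon₃ (_ ∷ _ ∷ []) _ (here refl) (there (here refl)) (there (here refl)) _ bc _ = bc refl
pigeon₃ (_ ∷ _ ∷ []) _ (there (here refl)) (here refl) (here refl) _ bc _ = bc refl
pigeon₃ (_ ∷ _ ∷ []) _ (there (here refl)) (here refl) (there (here refl)) _ _ ac = ac refl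
pigeon₃ (_ ∷ _ ∷ []) _ (there (here refl)) (there (here refl)) _ ab _ _ = ab refl
pigeon₃ (_ ∷ _ ∷ []) _ _ _ (there (there ())) _ _ _
pigeon₃ (_ ∷ _ ∷ []) _ _ (there (there ())) _ _ _ _
pigeon₃ (_ ∷ _ ∷ []) _ (there (there ())) _ _ _ _ _

fresh : ∀ {m} (L : List (Fin m)) → length L < m → ∃ λ z → z ∉ L
fresh {m} L short = ¬∀⟶∃¬ m (_∈ L) (_∈? L) notAll
  where
  open DecMembership (_≟_ {m}) using (_∈?_)
  notAll : ¬ (∀ z → z ∈ L)
  notAll all with pigeonhole short (λ z → index (all z))
  ... | i , j , i<j , same = <⇒≢ i<j (trans (lookup-index (all i))
                              (trans (cong (lookup L) same) (sym (lookup-index (all j)))))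

distinct₄ : ∀ {m} (a b c d : Fin m) →
  a ≢ b → a ≢ c → a ≢ d → b ≢ c → b ≢ d → c ≢ d → 4 ≤ m
distinct₄ {m} a b c d ab ac ad bc bd cd = injective⇒≤ {f = pick} pick-injective
  where
  pick : Fin 4 → Fin m
  pick zero = a
  pick (suc zero) = b
  pick (suc (suc zero)) = c
  pick (suc (suc (suc zero))) = d
  pick-injective : ∀ {x y} → pick x ≡ pick y → x ≡ y
  pick-injective {zero} {zero} e = refl
  pick-injective {zero} {suc zero} e = ⊥-elim (ab e)
  pick-injective {zero} {suc (suc zero)} e = ⊥-elim (ac e)
  pick-injective {zero} {suc (suc (suc zero))} e = ⊥-elim (ad e)
  pick-injective {suc zero} {zero} e = ⊥-elim (ab (sym e))
  pick-injective {suc zero} {suc zero} e = refl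
  pick-injective {suc zero} {suc (suc zero)} e = ⊥-elim (bc e)
  pick-injective {suc zero} {suc (suc (suc zero))} e = ⊥-elim (bd e)
  pick-injective {suc (suc zero)} {zero} e = ⊥-elim (ac (sym e))
  pick-injective {suc (suc zero)} {suc zero} e = ⊥-elim (bc (sym e))
  pick-injective {suc (suc zero)} {suc (suc zero)} e = refl
  pick-injective {suc (suc zero)} {suc (suc (suc zero))} e = ⊥-elim (cd e)
  pick-injective {suc (suc (suc zero))} {zero} e = ⊥-elim (ad (sym e))
  pick-injective {suc (suc (suc zero))} {suc zero} e = ⊥-elim (bd (sym e))
  pick-injective {suc (suc (suc zero))} {suc (suc zero)} e = ⊥-elim (cd (sym e))
  pick-injective {suc (suc (suc zero))} {suc (suc (suc zero))} e = refl

-- Three routes u–o, u–y–o₁, u–z–o₂ with pairwise disjoint vertex sets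
-- (besides u) cannot all be blocked by two vertices: some route leads from
-- u ∉ S to one of its targets o, o₁, o₂ while avoiding S.
module _ (G : Graph) (S : List (V G)) (small : length S ≤ 2) (P : V G → Set)
  {u : V G} (u∉ : u ∉ S) where
  open DecMembership (_≟_ {n G}) using (_∈?_)

  Escape : Set
  Escape = ∃ λ t → P t × t ∉ S × Walk G (_∉ S) u t

  twoStep : ∀ {x y} → Adj G u x → Adj G x y → P y → Escape ⊎ (x ∈ S ⊎ y ∈ S)
  twoStep {x} {y} ux xy Py with x ∈? S | y ∈? S
  ... | yes x∈ | _ = inj₂ (inj₁ x∈)
  ... | no _ | yes y∈ = inj₂ (inj₂ y∈)
  ... | no x∉ | no y∉ = inj₁ (y , Py , y∉ , cons u∉ ux (edge x∉ y∉ xy))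

  escape : ∀ {o y o₁ z o₂} →
    Adj G u o → Adj G u y → Adj G y o₁ → Adj G u z → Adj G z o₂ →
    P o → P o₁ → P o₂ →
    o ≢ y → o ≢ o₁ → o ≢ z → o ≢ o₂ → y ≢ z → y ≢ o₂ → o₁ ≢ z → o₁ ≢ o₂ →
    Escape
  escape {o} {y} {o₁} {z} {o₂} uo uy yo₁ uz zo₂ Po Po₁ Po₂
         o≢y o≢o₁ o≢z o≢o₂ y≢z y≢o₂ o₁≢z o₁≢o₂
    with o ∈? S | twoStep uy yo₁ Po₁ | twoStep uz zo₂ Po₂
  ... | no o∉ | _ | _ = o , Po , o∉ , edge u∉ o∉ uo
  ... | yes _ | inj₁ found | _ = found
  ... | yes _ | inj₂ _ | inj₁ found = found
  ... | yes o∈ | inj₂ (inj₁ y∈) | inj₂ (inj₁ z∈) =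
    ⊥-elim (pigeon₃ S small o∈ y∈ z∈ o≢y y≢z o≢z)
  ... | yes o∈ | inj₂ (inj₁ y∈) | inj₂ (inj₂ o₂∈) =
    ⊥-elim (pigeon₃ S small o∈ y∈ o₂∈ o≢y y≢o₂ o≢o₂)
  ... | yes o∈ | inj₂ (inj₂ o₁∈) | inj₂ (inj₁ z∈) =
    ⊥-elim (pigeon₃ S small o∈ o₁∈ z∈ o≢o₁ o₁≢z o≢z)
  ... | yes o∈ | inj₂ (inj₂ o₁∈) | inj₂ (inj₂ o₂∈) =
    ⊥-elim (pigeon₃ S small o∈ o₁∈ o₂∈ o≢o₁ o₁≢o₂ o≢o₂)

-- Since 3-connectivity of H makes H − S' connected,
-- vertices of G − S that can enter g(H − S') are joined in G − S, provided
-- every H-edge of H − S' lifts to a walk of G − S.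
module Transfer (G H : Graph) (VH : VertexConnected 3 H)
  (k : V G → V H) (g : V H → V G) (section : ∀ y → k (g y) ≡ y)
  (S : List (V G)) (small : suc (length S) ≤ 3) where

  S' : List (V H)
  S' = map k S

  avoids : ∀ y → y ∉ S' → g y ∉ S
  avoids y y∉ gy∈ = y∉ (subst (_∈ S') (section y) (∈-map⁺ k gy∈))

  LiftsEdges : Set
  LiftsEdges = ∀ y y' → y ∉ S' → y' ∉ S' → Adj H y y' → Walk G (_∉ S) (g y) (g y')

  Entry : V G → Set
  Entry u = ∃ λ x → x ∉ S' × Walk G (_∉ S) u (g x)

  join : LiftsEdges → ∀ {u v} → Entry u → Entry v → Walk G (_∉ S) u v
  join lifts (x , x∉ , wu) (x' , x'∉ , wv) =
    wu ++w (mapW g avoids lifts (proj₂ VH S' small' x x' x∉ x'∉) ++w rev wv)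
    where
    small' : suc (length S') ≤ 3
    small' = subst (λ l → suc l ≤ 3) (sym (length-map k S)) small

complete-connected : ∀ G → (∀ u v → u ≢ v → Adj G u v) → ∀ S → ConnectedWithout G S
complete-connected G complete S u v u∉ v∉ with u ≟ v
... | yes refl = here u∉
... | no u≢v = edge u∉ v∉ (complete u v u≢v)

k4-connected : ∀ G → G ≅ K4 → VertexConnected 3 G
k4-connected G (φ , preserves) =
  injective⇒≤ {f = from} from-injective , λ S _ → complete-connected G complete S
  where
  open Inverse φ
  from-injective : ∀ {x y} → from x ≡ from y → x ≡ y
  from-injective {x} {y} e = trans (sym (strictlyInverseˡ x)) (trans (cong to e) (strictlyInverseˡ y))
  to-injective : ∀ {x y} → to x ≡ to y → x ≡ y
  to-injective {x} {y} e = trans (sym (strictlyInverseʳ x)) (trans (cong from e) (strictlyInverseʳ y))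
  complete : ∀ u v → u ≢ v → Adj G u v
  complete u v u≢v with to u ≟ to v | preserves u v
  ... | yes e | _ = ⊥-elim (u≢v (to-injective e))
  ... | no _ | adjacent = sym adjacent

module D3aStep (G H : Graph) (p q r a b c : V G)
  (pq : p ≢ q) (qr : q ≢ r) (pr : p ≢ r)
  (Apq : Adj G p q) (Aqr : Adj G q r) (Apr : Adj G p r)
  (Apa : Adj G p a) (Aqb : Adj G q b) (Arc : Adj G r c)
  (ap : a ≢ p) (aq : a ≢ q) (ar : a ≢ r) (bp : b ≢ p) (bq : b ≢ q) (br : b ≢ r)
  (cp : c ≢ p) (cq : c ≢ q) (cr : c ≢ r) (ab : a ≢ b) (bc : b ≢ c) (ac : a ≢ c)
  (f : V G → V H) (w : V H)
  (fp : f p ≡ w) (fq : f q ≡ w) (fr : f r ≡ w)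
  (fsurj : ∀ y → ∃ λ x → f x ≡ y)
  (fnw : ∀ x → x ≢ p → x ≢ q → x ≢ r → f x ≢ w)
  (finj : ∀ x y → x ≢ p → x ≢ q → x ≢ r → y ≢ p → y ≢ q → y ≢ r → f x ≡ f y → x ≡ y)
  (fadj : ∀ x y → x ≢ p → x ≢ q → x ≢ r → y ≢ p → y ≢ q → y ≢ r →
          adj H (f x) (f y) ≡ adj G x y)
  (fw : ∀ x → x ≢ p → x ≢ q → x ≢ r →
          (Adj H w (f x) → (x ≡ a ⊎ x ≡ b ⊎ x ≡ c))
        × ((x ≡ a ⊎ x ≡ b ⊎ x ≡ c) → Adj H w (f x)))
  (VH : VertexConnected 3 H) where

  Tri Out : V G → Set
  Tri x = x ≡ p ⊎ x ≡ q ⊎ x ≡ r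
  Out x = x ≢ p × x ≢ q × x ≢ r

  tri? : ∀ x → Tri x ⊎ Out x
  tri? x with x ≟ p | x ≟ q | x ≟ r
  ... | yes e | _ | _ = inj₁ (inj₁ e)
  ... | no _ | yes e | _ = inj₁ (inj₂ (inj₁ e))
  ... | no _ | no _ | yes e = inj₁ (inj₂ (inj₂ e))
  ... | no x≢p | no x≢q | no x≢r = inj₂ (x≢p , x≢q , x≢r)

  f-Tri : ∀ {x} → Tri x → f x ≡ w
  f-Tri (inj₁ refl) = fp
  f-Tri (inj₂ (inj₁ refl)) = fq
  f-Tri (inj₂ (inj₂ refl)) = fr

  f-Out : ∀ {x} → Out x → f x ≢ w
  f-Out {x} (x≢p , x≢q , x≢r) = fnw x x≢p x≢q x≢r

  f-inj : ∀ {x y} → Out x → Out y → f x ≡ f y → x ≡ y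
  f-inj {x} {y} (x≢p , x≢q , x≢r) (y≢p , y≢q , y≢r) = finj x y x≢p x≢q x≢r y≢p y≢q y≢r

  a-Out : Out a
  a-Out = ap , aq , ar
  b-Out : Out b
  b-Out = bp , bq , br
  c-Out : Out c
  c-Out = cp , cq , cr

  g : V H → V G
  g y = proj₁ (fsurj y)

  fg : ∀ y → f (g y) ≡ y
  fg y = proj₂ (fsurj y)

  g-Tri : Tri (g w)
  g-Tri with tri? (g w)
  ... | inj₁ t = t
  ... | inj₂ out = ⊥-elim (f-Out out (fg w))

  g-Out : ∀ y → y ≢ w → Out (g y)
  g-Out y y≢w with tri? (g y)
  ... | inj₁ t = ⊥-elim (y≢w (trans (sym (fg y)) (f-Tri t)))
  ... | inj₂ out = out

  gf : ∀ {x} → Out x → g (f x) ≡ x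
  gf {x} out = f-inj (g-Out (f x) (f-Out out)) out (fg (f x))

  adj-Out : ∀ y y' → Out (g y) → Out (g y') → Adj H y y' → Adj G (g y) (g y')
  adj-Out y y' (x≢p , x≢q , x≢r) (x'≢p , x'≢q , x'≢r) e =
    trans (sym (fadj _ _ x≢p x≢q x≢r x'≢p x'≢q x'≢r)) (trans (cong₂ (adj H) (fg y) (fg y')) e)

  w-neighbour : ∀ {x} → Out x → Adj H w (f x) → x ≡ a ⊎ x ≡ b ⊎ x ≡ c
  w-neighbour {x} (x≢p , x≢q , x≢r) = proj₁ (fw x x≢p x≢q x≢r)

  -- A triangle vertex outside S escapes to a non-triangle vertex outside S:
  -- its three routes via its own and the two other outside neighbours are
  -- disjoint, so S, of size two, cannot block them all.
  escapeTri : ∀ S → length S ≤ 2 → ∀ {u} → Tri u → u ∉ S →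
    ∃ λ t → Out t × t ∉ S × Walk G (_∉ S) u t
  escapeTri S small (inj₁ refl) u∉ =
    escape G S small Out u∉ Apa Apq Aqb Apr Arc a-Out b-Out c-Out
      aq ab ar ac qr (≢-sym cq) br bc
  escapeTri S small (inj₂ (inj₁ refl)) u∉ =
    escape G S small Out u∉ Aqb (adjSym G Apq) Apa Aqr Arc b-Out a-Out c-Out
      bp (≢-sym ab) br bc pr (≢-sym cp) ar ac
  escapeTri S small (inj₂ (inj₂ refl)) u∉ =
    escape G S small Out u∉ Arc (adjSym G Apr) Apa (adjSym G Aqr) Aqb c-Out a-Out b-Out
      cp (≢-sym ac) cq (≢-sym bc) pq (≢-sym bp) aq ab

  module _ (S : List (V G)) (small : suc (length S) ≤ 3) where
    open Transfer G H VH f g fg S small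

    triangle-free : w ∉ S' → ∀ {x} → Tri x → x ∉ S
    triangle-free w∉ t x∈ = w∉ (subst (_∈ S') (f-Tri t) (∈-map⁺ f x∈))

    toP : w ∉ S' → ∀ {t} → Tri t → Walk G (_∉ S) t p
    toP w∉ (inj₁ refl) = here (triangle-free w∉ (inj₁ refl))
    toP w∉ (inj₂ (inj₁ refl)) =
      edge (triangle-free w∉ (inj₂ (inj₁ refl))) (triangle-free w∉ (inj₁ refl)) (adjSym G Apq)
    toP w∉ (inj₂ (inj₂ refl)) =
      edge (triangle-free w∉ (inj₂ (inj₂ refl))) (triangle-free w∉ (inj₁ refl)) (adjSym G Apr)

    pToNeighbour : w ∉ S' → ∀ {x} → x ≡ a ⊎ x ≡ b ⊎ x ≡ c → x ∉ S → Walk G (_∉ S) p x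
    pToNeighbour w∉ (inj₁ refl) x∉ = edge (triangle-free w∉ (inj₁ refl)) x∉ Apa
    pToNeighbour w∉ (inj₂ (inj₁ refl)) x∉ =
      cons (triangle-free w∉ (inj₁ refl)) Apq (edge (triangle-free w∉ (inj₂ (inj₁ refl))) x∉ Aqb)
    pToNeighbour w∉ (inj₂ (inj₂ refl)) x∉ =
      cons (triangle-free w∉ (inj₁ refl)) Apr (edge (triangle-free w∉ (inj₂ (inj₂ refl))) x∉ Arc)

    liftAtW : w ∉ S' → ∀ y → y ∉ S' → y ≢ w → Adj H w y → Walk G (_∉ S) (g w) (g y)
    liftAtW w∉ y y∉ y≢w e =
      toP w∉ g-Tri ++w pToNeighbour w∉ (w-neighbour out w~gy) (avoids y y∉)
      where
      out : Out (g y)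
      out = g-Out y y≢w
      w~gy : Adj H w (f (g y))
      w~gy = subst (Adj H w) (sym (fg y)) e

    lifts : LiftsEdges
    lifts y y' y∉ y'∉ e with y ≟ w | y' ≟ w
    ... | yes refl | yes refl = ⊥-elim (adjNe H e refl)
    ... | yes refl | no y'≢w = liftAtW y∉ y' y'∉ y'≢w e
    ... | no y≢w | yes refl = rev (liftAtW y'∉ y y∉ y≢w (adjSym H e))
    ... | no y≢w | no y'≢w =
      edge (avoids y y∉) (avoids y' y'∉) (adj-Out y y' (g-Out y y≢w) (g-Out y' y'≢w) e)

    image-avoids : ∀ {u} → Out u → u ∉ S → f u ∉ S'
    image-avoids out u∉ fu∈ with ∈-map⁻ f fu∈
    ... | x , x∈ , fu≡fx with tri? x
    ...   | inj₁ t = f-Out out (trans fu≡fx (f-Tri t))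
    ...   | inj₂ out' = u∉ (subst (_∈ S) (sym (f-inj out out' fu≡fx)) x∈)

    enterOut : ∀ {u} → Out u → u ∉ S → Entry u
    enterOut {u} out u∉ = f u , image-avoids out u∉ , subst (Walk G (_∉ S) u) (sym (gf out)) (here u∉)

    enter : ∀ u → u ∉ S → Entry u
    enter u u∉ with tri? u
    ... | inj₂ out = enterOut out u∉
    ... | inj₁ t with escapeTri S (s≤s⁻¹ small) t u∉
    ...   | t' , out , t'∉ , walk with enterOut out t'∉
    ...     | x , x∉ , walk' = x , x∉ , walk ++w walk'

    connected : ConnectedWithout G S
    connected u v u∉ v∉ = join lifts (enter u u∉) (enter v v∉)

d3a-reflects : ∀ {G H} → D3a G H → VertexConnected 3 H → VertexConnected 3 G
d3a-reflects {G} {H}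
  (p , q , r , a , b , c , (pq , qr , pr) , _ , (Apq , Aqr , Apr) , (Apa , Aqb , Arc) ,
   (ap , aq , ar , bp , bq , br , cp , cq , cr) , (ab , bc , ac) ,
   f , w , (fp , fq , fr) , fsurj , fnw , finj , fadj , fw) VH =
  distinct₄ p q r a pq pr (≢-sym ap) qr (≢-sym aq) (≢-sym ar) , connected
  where
  open D3aStep G H p q r a b c pq qr pr Apq Aqr Apr Apa Aqb Arc ap aq ar bp bq br cp cq cr
                 ab bc ac f w fp fq fr fsurj fnw finj fadj fw VH

module D3bStep (G H : Graph) (p q r s : V G)
  (pq : p ≢ q) (qr : q ≢ r) (pr : p ≢ r)
  (Apq : Adj G p q) (Aqr : Adj G q r)
  (Asp : Adj G s p) (Asq : Adj G s q) (Asr : Adj G s r)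
  (f : V H → V G)
  (finj : ∀ x y → f x ≡ f y → x ≡ y)
  (fq : ∀ x → f x ≢ q)
  (fsurj : ∀ z → z ≢ q → ∃ λ x → f x ≡ z)
  (fadj : ∀ x y → (Adj H x y →
                 (Adj G (f x) (f y) ⊎ (f x ≡ p × f y ≡ r) ⊎ (f x ≡ r × f y ≡ p)))
             × ((Adj G (f x) (f y) ⊎ (f x ≡ p × f y ≡ r) ⊎ (f x ≡ r × f y ≡ p))
                 → Adj H x y))
  (VH : VertexConnected 3 H) where

  open DecMembership (_≟_ {n G}) using (_∈?_)

  sp : s ≢ p
  sp = adjNe G Asp
  sq : s ≢ q
  sq = adjNe G Asq
  sr : s ≢ r
  sr = adjNe G Asr

  pre : ∀ z → z ≢ q → V H
  pre z z≢q = proj₁ (fsurj z z≢q)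

  f-pre : ∀ z z≢q → f (pre z z≢q) ≡ z
  f-pre z z≢q = proj₂ (fsurj z z≢q)

  pull : V H → V G → V H
  pull d z with z ≟ q
  ... | yes _ = d
  ... | no z≢q = pre z z≢q

  pull-f : ∀ d x → pull d (f x) ≡ x
  pull-f d x with f x ≟ q
  ... | yes fx≡q = ⊥-elim (fq x fx≡q)
  ... | no fx≢q = finj _ _ (f-pre (f x) fx≢q)

  pull-q : ∀ d → pull d q ≡ d
  pull-q d with q ≟ q
  ... | yes _ = refl
  ... | no q≢q = ⊥-elim (q≢q refl)

  module Pullback (S : List (V G)) (small : suc (length S) ≤ 3) (d : V H) where
    open Transfer G H VH (pull d) f (pull-f d) S small public

    outside : ∀ {x} → f x ∉ S → (q ∈ S → x ≢ d) → x ∉ S'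
    outside {x} fx∉ x≢d x∈ with ∈-map⁻ (pull d) x∈
    ... | z , z∈ , x≡pull with z ≟ q
    ...   | yes refl = x≢d z∈ x≡pull
    ...   | no z≢q = fx∉ (subst (_∈ S) (sym (trans (cong f x≡pull) (f-pre z z≢q))) z∈)

    d-deleted : q ∈ S → d ∈ S'
    d-deleted q∈ = subst (_∈ S') (pull-q d) (∈-map⁺ (pull d) q∈)

    Bypass : Set
    Bypass = ∀ y y' → y ∉ S' → y' ∉ S' → f y ≡ p → f y' ≡ r → Walk G (_∉ S) p r

    lifts : Bypass → LiftsEdges
    lifts bypass y y' y∉ y'∉ e with proj₁ (fadj y y') e
    ... | inj₁ e' = edge (avoids y y∉) (avoids y' y'∉) e'
    ... | inj₂ (inj₁ (fy≡p , fy'≡r)) =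
      subst₂ (Walk G (_∉ S)) (sym fy≡p) (sym fy'≡r) (bypass y y' y∉ y'∉ fy≡p fy'≡r)
    ... | inj₂ (inj₂ (fy≡r , fy'≡p)) =
      subst₂ (Walk G (_∉ S)) (sym fy≡r) (sym fy'≡p) (rev (bypass y' y y'∉ y∉ fy'≡p fy≡r))

    bypassThroughQ : q ∉ S → Bypass
    bypassThroughQ q∉ y y' y∉ y'∉ fy≡p fy'≡r =
      cons (subst (_∉ S) fy≡p (avoids y y∉)) Apq (edge q∉ (subst (_∉ S) fy'≡r (avoids y' y'∉)) Aqr)

    -- If q is deleted and d stands for p or r, the edge pr is not in H − S'.
    noBypass : q ∈ S → f d ≡ p ⊎ f d ≡ r → Bypass
    noBypass q∈ (inj₁ fd≡p) y _ y∉ _ fy≡p _ =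
      ⊥-elim (y∉ (subst (_∈ S') (sym (finj y d (trans fy≡p (sym fd≡p)))) (d-deleted q∈)))
    noBypass q∈ (inj₂ fd≡r) _ y' _ y'∉ _ fy'≡r =
      ⊥-elim (y'∉ (subst (_∈ S') (sym (finj y' d (trans fy'≡r (sym fd≡r)))) (d-deleted q∈)))

    enter : ∀ u (u≢q : u ≢ q) → u ∉ S → (q ∈ S → pre u u≢q ≢ d) → Entry u
    enter u u≢q u∉ pre≢d =
      pre u u≢q , outside (subst (_∉ S) (sym (f-pre u u≢q)) u∉) pre≢d ,
      subst (Walk G (_∉ S) u) (sym (f-pre u u≢q)) (here u∉)

  -- If q survives, its three neighbours p, r, s cannot all be deleted.
  module QSurvives (S : List (V G)) (small : suc (length S) ≤ 3) (q∉ : q ∉ S) where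
    open Pullback S small (pre p pq)

    survivingNeighbour : ∃ λ m → m ≢ q × m ∉ S × Adj G q m
    survivingNeighbour with p ∈? S | r ∈? S | s ∈? S
    ... | no p∉ | _ | _ = p , pq , p∉ , adjSym G Apq
    ... | yes _ | no r∉ | _ = r , ≢-sym qr , r∉ , Aqr
    ... | yes _ | yes _ | no s∉ = s , sq , s∉ , adjSym G Asq
    ... | yes p∈ | yes r∈ | yes s∈ =
      ⊥-elim (pigeon₃ S (s≤s⁻¹ small) p∈ r∈ s∈ pr (≢-sym sr) (≢-sym sp))

    enterAny : ∀ u → u ∉ S → Entry u
    enterAny u u∉ with u ≟ q
    ... | no u≢q = enter u u≢q u∉ (λ q∈ → ⊥-elim (q∉ q∈))
    ... | yes refl with survivingNeighbour
    ...   | m , m≢q , m∉ , qm with enter m m≢q m∉ (λ q∈ → ⊥-elim (q∉ q∈))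
    ...     | x , x∉ , walk = x , x∉ , cons u∉ qm walk

    connected : ConnectedWithout G S
    connected u v u∉ v∉ = join (lifts (bypassThroughQ q∉)) (enterAny u u∉) (enterAny v v∉)

  -- If q is deleted, pulling back with d a preimage of p joins all
  -- vertices but p, and likewise for r; p and r themselves are joined
  -- through s or through some further vertex.
  module QDeleted (S : List (V G)) (small : suc (length S) ≤ 3) (q∈ : q ∈ S) where
    survives-≢q : ∀ {u} → u ∉ S → u ≢ q
    survives-≢q u∉ u≡q = u∉ (subst (_∈ S) (sym u≡q) q∈)

    avoiding : ∀ d → f d ≡ p ⊎ f d ≡ r →
      ∀ u v → u ∉ S → v ∉ S → u ≢ f d → v ≢ f d → Walk G (_∉ S) u v
    avoiding d fd u v u∉ v∉ u≢fd v≢fd =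
      join (lifts (noBypass q∈ fd)) (enterAvoiding u∉ u≢fd) (enterAvoiding v∉ v≢fd)
      where
      open Pullback S small d
      enterAvoiding : ∀ {u} → u ∉ S → u ≢ f d → Entry u
      enterAvoiding {u} u∉ u≢fd = enter u (survives-≢q u∉) u∉
        (λ _ pre≡d → u≢fd (trans (sym (f-pre u (survives-≢q u∉))) (cong f pre≡d)))

    avoidingP : ∀ u v → u ∉ S → v ∉ S → u ≢ p → v ≢ p → Walk G (_∉ S) u v
    avoidingP u v u∉ v∉ u≢p v≢p = avoiding (pre p pq) (inj₁ (f-pre p pq)) u v u∉ v∉
      (λ e → u≢p (trans e (f-pre p pq))) (λ e → v≢p (trans e (f-pre p pq)))

    avoidingR : ∀ u v → u ∉ S → v ∉ S → u ≢ r → v ≢ r → Walk G (_∉ S) u v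
    avoidingR u v u∉ v∉ u≢r v≢r = avoiding (pre r (≢-sym qr)) (inj₂ (f-pre r (≢-sym qr))) u v u∉ v∉
      (λ e → u≢r (trans e (f-pre r _))) (λ e → v≢r (trans e (f-pre r _)))

    -- With S = {q, s}, H has a fourth vertex besides the preimages of p, r, s.
    spare : s ∈ S → ∃ λ z → z ∉ S × z ≢ p × z ≢ r
    spare s∈ with fresh (pre p pq ∷ pre r (≢-sym qr) ∷ pre s sq ∷ []) (proj₁ VH)
    ... | z , z∉ = f z , fz∉ ,
                   (λ e → z∉ (here (finj _ _ (trans e (sym (f-pre p pq)))))) ,
                   (λ e → z∉ (there (here (finj _ _ (trans e (sym (f-pre r _)))))))
      where
      fz∉ : f z ∉ S
      fz∉ fz∈ = pigeon₃ S (s≤s⁻¹ small) fz∈ q∈ s∈ (fq z) (≢-sym sq)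
                  (λ e → z∉ (there (there (here (finj _ _ (trans e (sym (f-pre s sq))))))))

    pToR : p ∉ S → r ∉ S → Walk G (_∉ S) p r
    pToR p∉ r∉ with s ∈? S
    ... | no s∉ = cons p∉ (adjSym G Asp) (edge s∉ r∉ Asr)
    ... | yes s∈ with spare s∈
    ...   | z , z∉ , z≢p , z≢r =
      avoidingR p z p∉ z∉ pr z≢r ++w avoidingP z r z∉ r∉ z≢p (≢-sym pr)

    connected : ConnectedWithout G S
    connected u v u∉ v∉ with u ≟ p | v ≟ p | u ≟ r | v ≟ r
    ... | no u≢p | no v≢p | _ | _ = avoidingP u v u∉ v∉ u≢p v≢p
    ... | _ | _ | no u≢r | no v≢r = avoidingR u v u∉ v∉ u≢r v≢r
    ... | yes refl | _ | yes p≡r | _ = ⊥-elim (pr p≡r)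
    ... | _ | yes refl | _ | yes p≡r = ⊥-elim (pr p≡r)
    ... | yes refl | _ | no _ | yes refl = pToR u∉ v∉
    ... | no _ | yes refl | yes refl | no _ = rev (pToR v∉ u∉)

  connected : ∀ S → suc (length S) ≤ 3 → ConnectedWithout G S
  connected S small with q ∈? S
  ... | no q∉ = QSurvives.connected S small q∉
  ... | yes q∈ = QDeleted.connected S small q∈

d3b-reflects : ∀ {G H} → D3b G H → VertexConnected 3 H → VertexConnected 3 G
d3b-reflects {G} {H}
  (p , q , r , s , (pq , qr , pr) , _ , (Apq , Aqr , _) , (Asp , Asq , Asr) ,
   f , finj , fq , fsurj , fadj) VH =
  distinct₄ p q r s pq pr (≢-sym sp) qr (≢-sym sq) (≢-sym sr) , connected
  where
  open D3bStep G H p q r s pq qr pr Apq Aqr Asp Asq Asr f finj fq fsurj fadj VH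

theorem5 : (G : Graph) → D3Reducible G → VertexConnected 3 G
theorem5 G (done G≅K4) = k4-connected G G≅K4
theorem5 G (step (stepA red) rest) = d3a-reflects red (theorem5 _ rest)
theorem5 G (step (stepB red) rest) = d3b-reflects red (theorem5 _ rest)
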